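{- Let $\mathcal{P}$ be the set of all programs and $\mathcal{P}'$ the set of all programs that contain no choice rules. Then there is no mapping $T:\mathcal{P}\to\mathcal{P}'$ that preserves stable models, i.e. no $T$ such that for every $Q\in\mathcal{P}$ the programs $Q$ and $T(Q)$ have exactly the same stable models.
   Context: Fix a set $\mathit{Atoms}$ of atoms. A literal is an atom $a$ or a not-atom $\mathit{not}\ a$. A program is a set of rules, each of one of four forms (atoms $h,h_i,a_i,b_j\in\mathit{Atoms}$, sets $S,C\subseteq\mathit{Atoms}$): (basic) $h\leftarrow a_1,\dots,a_n,\mathit{not}\ b_1,\dots,\mathit{not}\ b_m$, with $f_r(S,C)=\{h\}$ if $a_1,\dots,a_n\in C$ and $b_1,\dots,b_m\notin S$, and $\emptyset$ otherwise; (cardinality) $h\leftarrow k\{a_1,\dots,a_n,\mathit{not}\ b_1,\dots,\mathit{not}\ b_m\}$, with $f_r(S,C)=\{h\}$ if $|\{a_1,\dots,a_n\}\cap C|+|\{b_1,\dots,b_m\}\setminus S|\ge k$, else $\emptyset$; (choice) $\{h_1,\dots,h_k\}\leftarrow a_1,\dots,a_n,\mathit{not}\ b_1,\dots,\mathit{not}\ b_m$, with $f_r(S,C)=\{h_1,\dots,h_k\}\cap S$ if $a_1,\dots,a_n\in C$ and $b_1,\dots,b_m\notin S$, else $\emptyset$; (weight) $h\leftarrow\{a_1=w_{a_1},\dots,a_n=w_{a_n},\mathit{not}\ b_1=w_{b_1},\dots,\mathit{not}\ b_m=w_{b_m}\}\ge w$ with all weights $\ge 0$, with $f_r(S,C)=\{h\}$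 if $\sum_{a_i\in C}w_{a_i}+\sum_{b_j\notin S}w_{b_j}\ge w$, else $\emptyset$. A function $f:2^{\mathit{Atoms}}\to2^{\mathit{Atoms}}$ is a closure of $P$ if $f(S)=\bigcup_{r\in P}f_r(S,f(S))$ for all $S$; $g_P(S)=\bigcap\{f(S)\mid f\text{ a closure of }P\}$. $S$ is a stable model of $P$ iff $S=g_P(S)$. -}

module Defs where

open import Data.Bool using (Bool; true; false; if_then_else_)
open import Data.Nat as ℕ using (ℕ)
open import Data.Rational as ℚ using (ℚ; 0ℚ)
open import Data.List using (List; []; _∷_; map; foldr; length; filter)
open import Data.List.Relation.Unary.All using (All)
open import Data.Product using (Σ; _×_; _,_; proj₁; proj₂; ∃)
open import Relation.Binary.PropositionalEquality using (_≡_)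
open import Relation.Nullary using (¬_)

module _ (Atoms : Set) where

  AtomSet : Set
  AtomSet = Atoms → Bool

  data Rule : Set where
    -- h ← a₁,…,aₙ, not b₁,…,not bₘ
    basic  : (h : Atoms) (pos neg : List Atoms) → Rule
    -- h ← k { a₁,…,aₙ, not b₁,…,not bₘ }
    card   : (h : Atoms) (k : ℕ) (pos neg : List Atoms) → Rule
    -- { h₁,…,h_k } ← a₁,…,aₙ, not b₁,…,not bₘ
    choice : (hs : List Atoms) (pos neg : List Atoms) → Rule
    -- h ← { a₁ = w₁,…, not b₁ = w'₁,… } ≥ w, all weights ≥ 0
    weight : (h : Atoms) (pos neg : List (Atoms × ℚ)) (w : ℚ) →
             All (λ p → 0ℚ ℚ.≤ proj₂ p) pos →
             All (λ p → 0ℚ ℚ.≤ proj₂ p) neg →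
             Rule

  Program : Set₁
  Program = Rule → Set

  _∈ₛ_ : Atoms → AtomSet → Set
  a ∈ₛ S = S a ≡ true

  _∉ₛ_ : Atoms → AtomSet → Set
  a ∉ₛ S = S a ≡ false

  countIn : AtomSet → List Atoms → ℕ
  countIn C []       = 0
  countIn C (a ∷ as) = (if C a then 1 else 0) ℕ.+ countIn C as

  countOut : AtomSet → List Atoms → ℕ
  countOut S []       = 0
  countOut S (b ∷ bs) = (if S b then 0 else 1) ℕ.+ countOut S bs

  sumIn : AtomSet → List (Atoms × ℚ) → ℚ
  sumIn C []             = 0ℚ
  sumIn C ((a , w) ∷ ws) = (if C a then w else 0ℚ) ℚ.+ sumIn C ws

  sumOut : AtomSet → List (Atoms × ℚ) → ℚ
  sumOut S []             = 0ℚ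
  sumOut S ((b , w) ∷ ws) = (if S b then 0ℚ else w) ℚ.+ sumOut S ws

  BodyHolds : AtomSet → AtomSet → List Atoms → List Atoms → Set
  BodyHolds S C pos neg = All (_∈ₛ C) pos × All (_∉ₛ S) neg

  InF : Rule → AtomSet → AtomSet → Atoms → Set
  InF (basic h pos neg) S C a =
    a ≡ h × BodyHolds S C pos neg
  InF (card h k pos neg) S C a =
    a ≡ h × k ℕ.≤ countIn C pos ℕ.+ countOut S neg
  InF (choice hs pos neg) S C a =
    (Data.List.Membership.Propositional._∈_ a hs × a ∈ₛ S) × BodyHolds S C pos neg
    where import Data.List.Membership.Propositional
  InF (weight h pos neg w _ _) S C a =
    a ≡ h × w ℚ.≤ sumIn C pos ℚ.+ sumOut S neg

  IsClosure : Program → (AtomSet → AtomSet) → Set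
  IsClosure P f = ∀ (S : AtomSet) (a : Atoms) →
    (a ∈ₛ f S → Σ Rule λ r → P r × InF r S (f S) a) ×
    (Σ Rule (λ r → P r × InF r S (f S) a) → a ∈ₛ f S)

  InG : Program → AtomSet → Atoms → Set
  InG P S a = ∀ (f : AtomSet → AtomSet) → IsClosure P f → a ∈ₛ f S

  StableModel : Program → AtomSet → Set
  StableModel P S = ∀ (a : Atoms) → (a ∈ₛ S → InG P S a) × (InG P S a → a ∈ₛ S)

  IsChoiceRule : Rule → Set
  IsChoiceRule (choice _ _ _) = Data.Unit.⊤ where import Data.Unit
  IsChoiceRule _              = Data.Empty.⊥ where import Data.Empty

  ChoiceFree : Program → Set
  ChoiceFree P = ∀ (r : Rule) → P r → ¬ IsChoiceRule r

{-# OPTIONS --safe #-}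
-- For a rule r without choice, f_r(S, C) is antitone in S and monotone in C.
-- Hence, in a choice-free program P with ∅ stable, every f_r(S, ∅) is
-- contained in f_r(∅, f(∅)) ⊆ f(∅) for every closure f, so in g_P(∅) = ∅;
-- thus the constant map S ↦ ∅ is a closure of P and ∅ is the only stable
-- model of P. The program {{a} ← | a ∈ Atoms}, however, has both ∅ and Atoms
-- as stable models.
module Submission where

open import Defs
open import Data.Bool using (Bool; true; false; if_then_else_)
open import Data.Bool.Properties using (¬-not)
open import Data.Empty using (⊥-elim)
open import Data.List using (List; []; _∷_; [_])
open import Data.List.Relation.Unary.All as All using (All; []; _∷_)
open import Data.List.Relation.Unary.Any using (here)
open import Data.Nat as ℕ using (z≤n)
import Data.Nat.Properties as ℕ
open import Data.Product using (Σ; _×_; _,_; proj₁; proj₂)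
open import Data.Rational as ℚ using (ℚ; 0ℚ)
import Data.Rational.Properties as ℚ
open import Data.Unit using (tt)
open import Relation.Binary using (Rel; Reflexive)
open import Relation.Binary.PropositionalEquality using (_≡_; refl; sym; trans)
open import Relation.Nullary using (¬_)

true≢false : ¬ (true ≡ false)
true≢false ()

module _ {c ℓ} {X : Set c} {_≤_ : Rel X ℓ} (≤-refl : Reflexive _≤_)
         {lo hi : X} (lo≤hi : lo ≤ hi) where

  if-mono : ∀ {x y : Bool} → (x ≡ true → y ≡ true) →
            (if x then hi else lo) ≤ (if y then hi else lo)
  if-mono {true}  {true}  _   = ≤-refl
  if-mono {true}  {false} x⇒y with () ← x⇒y refl
  if-mono {false} {true}  _   = lo≤hi
  if-mono {false} {false} _   = ≤-refl

  if-antitone : ∀ {x y : Bool} → (x ≡ true → y ≡ true) →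
                (if y then lo else hi) ≤ (if x then lo else hi)
  if-antitone {true}  {true}  _   = ≤-refl
  if-antitone {true}  {false} x⇒y with () ← x⇒y refl
  if-antitone {false} {true}  _   = lo≤hi
  if-antitone {false} {false} _   = ≤-refl

module _ {A : Set} where

  ∅ : AtomSet A
  ∅ _ = false

  full : AtomSet A
  full _ = true

  _∈_ _∉_ : A → AtomSet A → Set
  a ∈ S = _∈ₛ_ A a S
  a ∉ S = _∉ₛ_ A a S

  _⊆ₛ_ : AtomSet A → AtomSet A → Set
  S ⊆ₛ S′ = ∀ a → a ∈ S → a ∈ S′

  ∅-⊆ₛ : ∀ {S} → ∅ ⊆ₛ S
  ∅-⊆ₛ _ ()

  ⊆ₛ-∉ₛ : ∀ {S S′ a} → S′ ⊆ₛ S → a ∉ S → a ∉ S′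
  ⊆ₛ-∉ₛ {a = a} S′⊆S a∉S = ¬-not λ a∈S′ → true≢false (trans (sym (S′⊆S a a∈S′)) a∉S)

  NonNegative : List (A × ℚ) → Set
  NonNegative = All (λ p → 0ℚ ℚ.≤ proj₂ p)

  countIn-mono : ∀ {C C′} → C ⊆ₛ C′ → ∀ ps → countIn A C ps ℕ.≤ countIn A C′ ps
  countIn-mono C⊆C′ []       = z≤n
  countIn-mono C⊆C′ (p ∷ ps) =
    ℕ.+-mono-≤ (if-mono {_≤_ = ℕ._≤_} ℕ.≤-refl z≤n (C⊆C′ p)) (countIn-mono C⊆C′ ps)

  countOut-antitone : ∀ {S S′} → S′ ⊆ₛ S → ∀ ns → countOut A S ns ℕ.≤ countOut A S′ ns
  countOut-antitone S′⊆S []       = z≤n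
  countOut-antitone S′⊆S (n ∷ ns) =
    ℕ.+-mono-≤ (if-antitone {_≤_ = ℕ._≤_} ℕ.≤-refl z≤n (S′⊆S n))
               (countOut-antitone S′⊆S ns)

  sumIn-mono : ∀ {C C′} → C ⊆ₛ C′ → ∀ ps → NonNegative ps →
               sumIn A C ps ℚ.≤ sumIn A C′ ps
  sumIn-mono C⊆C′ []            []         = ℚ.≤-refl
  sumIn-mono C⊆C′ ((p , w) ∷ ps) (0≤w ∷ nn) =
    ℚ.+-mono-≤ (if-mono {_≤_ = ℚ._≤_} ℚ.≤-refl 0≤w (C⊆C′ p))
               (sumIn-mono C⊆C′ ps nn)

  sumOut-antitone : ∀ {S S′} → S′ ⊆ₛ S → ∀ ns → NonNegative ns →
                    sumOut A S ns ℚ.≤ sumOut A S′ ns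
  sumOut-antitone S′⊆S []             []         = ℚ.≤-refl
  sumOut-antitone S′⊆S ((n , w) ∷ ns) (0≤w ∷ nn) =
    ℚ.+-mono-≤ (if-antitone {_≤_ = ℚ._≤_} ℚ.≤-refl 0≤w (S′⊆S n))
               (sumOut-antitone S′⊆S ns nn)

  InF-mono : ∀ r → ¬ IsChoiceRule A r → ∀ {S S′ C C′} → S′ ⊆ₛ S → C ⊆ₛ C′ →
             ∀ {a} → InF A r S C a → InF A r S′ C′ a
  InF-mono (basic h pos neg) _ S′⊆S C⊆C′ (a≡h , pos⊆C , neg∩S≡∅) =
    a≡h , All.map (C⊆C′ _) pos⊆C , All.map (⊆ₛ-∉ₛ S′⊆S) neg∩S≡∅
  InF-mono (card h k pos neg) _ S′⊆S C⊆C′ (a≡h , k≤) =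
    a≡h , ℕ.≤-trans k≤ (ℕ.+-mono-≤ (countIn-mono C⊆C′ pos)
                                   (countOut-antitone S′⊆S neg))
  InF-mono (choice hs pos neg) notChoice _ _ _ = ⊥-elim (notChoice tt)
  InF-mono (weight h pos neg w 0≤pos 0≤neg) _ S′⊆S C⊆C′ (a≡h , w≤) =
    a≡h , ℚ.≤-trans w≤ (ℚ.+-mono-≤ (sumIn-mono C⊆C′ pos 0≤pos)
                                   (sumOut-antitone S′⊆S neg 0≤neg))

  stable-∅⇒const-∅-isClosure : ∀ {P} → ChoiceFree A P → StableModel A P ∅ →
                                IsClosure A P (λ _ → ∅)
  stable-∅⇒const-∅-isClosure {P} choiceFree ∅-stable S a = (λ ()) , no-rule-fires
    where
    no-rule-fires : Σ (Rule A) (λ r → P r × InF A r S ∅ a) → a ∈ ∅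
    no-rule-fires (r , r∈P , a∈fᵣ) with () ← proj₂ (∅-stable a) (λ f f-closure →
      proj₂ (f-closure ∅ a) (r , r∈P , InF-mono r (choiceFree r r∈P) ∅-⊆ₛ ∅-⊆ₛ a∈fᵣ))

  const-∅-isClosure⇒stable-empty : ∀ {P S} → IsClosure A P (λ _ → ∅) →
                                    StableModel A P S → ∀ a → a ∉ S
  const-∅-isClosure⇒stable-empty {S = S} ∅-closure S-stable a with S a in a∈?S
  ... | false = refl
  ... | true with () ← proj₁ (S-stable a) a∈?S (λ _ → ∅) ∅-closure

  choiceFree-stable-unique : ∀ {P S} → ChoiceFree A P → StableModel A P ∅ →
                             StableModel A P S → ∀ a → a ∉ S
  choiceFree-stable-unique choiceFree ∅-stable =
    const-∅-isClosure⇒stable-empty (stable-∅⇒const-∅-isClosure choiceFree ∅-stable)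

  freeChoice : Program A
  freeChoice r = Σ A λ a → r ≡ choice [ a ] [] []

  freeChoice-chosen : ∀ {S C a} → a ∈ S → Σ (Rule A) λ r → freeChoice r × InF A r S C a
  freeChoice-chosen {a = a} a∈S =
    choice [ a ] [] [] , (a , refl) , (here refl , a∈S) , [] , []

  id-isClosure : IsClosure A freeChoice (λ S → S)
  id-isClosure S a = freeChoice-chosen , λ { (_ , (_ , refl) , (_ , a∈S) , _) → a∈S }

  freeChoice-stable-∅ : StableModel A freeChoice ∅
  freeChoice-stable-∅ a = (λ ()) , λ a∈g → a∈g (λ S → S) id-isClosure

  freeChoice-stable-full : StableModel A freeChoice full
  freeChoice-stable-full a =
    (λ _ f f-closure → proj₂ (f-closure full a) (freeChoice-chosen refl)) , (λ _ → refl)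

mainTheorem4 : (Atoms : Set) → Atoms →
    ¬ (Σ (Program Atoms → Program Atoms) λ T →
        (∀ (Q : Program Atoms) → ChoiceFree Atoms (T Q)) ×
        (∀ (Q : Program Atoms) (S : AtomSet Atoms) →
           (StableModel Atoms Q S → StableModel Atoms (T Q) S) ×
           (StableModel Atoms (T Q) S → StableModel Atoms Q S)))
mainTheorem4 Atoms a (_ , choiceFree , preserves) =
  true≢false (choiceFree-stable-unique (choiceFree freeChoice)
    (proj₁ (preserves freeChoice ∅) freeChoice-stable-∅)
    (proj₁ (preserves freeChoice full) freeChoice-stable-full) a)
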